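{- Consider a pullback square in $\mathbf{Gpd}$ consisting of $P$ with projections $l:P\to S$ and $r:P\to T$ over the cospan $S\xrightarrow{f}B\xleftarrow{g}T$ (so $fl=gr$). This square, regarded as a pseudocone with identity $2$-cell, is a bipullback if and only if the following holds: for all objects $s\in S$, $t\in T$ and every morphism $\theta\in B(fs,gt)$, there exist objects $s'\in S$, $t'\in T$ and morphisms $\varphi\in S(s,s')$, $\psi\in T(t',t)$ such that $fs'=gt'$ and $\theta=f\psi\circ g\varphi$.
   Context: $\mathbf{Gpd}$ is the $2$-category of small groupoids, functors and natural transformations (necessarily invertible). For a cospan $S\xrightarrow{u}B\xleftarrow{v}T$ in $\mathbf{Gpd}$: - A pseudocone with vertex $X$ is a triple $(l',r',\nu)$ with $l':X\to S$, $r':X\to T$ and $\nu:ul'\Rightarrow vr'$. - A morphism $(l',r',\nu)\to(l'',r'',\nu'')$ of pseudocones with vertex $X$ is a pair $\alpha:l'\Rightarrow l''$, $\beta:r'\Rightarrow r''$ with $\nu''\circ(u\alpha)=(v\beta)\circ\nu$. - A pseudocone $(P,l,r,\mu)$ is a bipullback if for every groupoid $X$ the functor from $\mathbf{Gpd}(X,P)$ to the category of pseudocones with vertex $X$, $h\mapsto(lh,rh,\mu h)$, $\theta\mapsto(l\theta,r\theta)$, is an equivalence of categories. -}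

module Defs where

open import Level using (0ℓ)
open import Data.Product using (Σ; Σ-syntax; _×_; _,_; proj₁; proj₂)
open import Relation.Binary.PropositionalEquality using (_≡_; refl)
open import Relation.Binary.Structures using (IsEquivalence)
open import Relation.Binary.Bundles using (Setoid)
import Relation.Binary.Reasoning.Setoid as SetoidR

record Groupoid : Set₁ where
  infix  4 _≈_
  infixr 9 _∘_
  infix  10 _⁻¹
  field
    Obj     : Set
    Hom     : Obj → Obj → Set
    _≈_     : ∀ {a b} → Hom a b → Hom a b → Set
    isEquiv : ∀ {a b} → IsEquivalence (_≈_ {a} {b})
    id      : ∀ {a} → Hom a a
    _∘_     : ∀ {a b c} → Hom b c → Hom a b → Hom a c
    _⁻¹     : ∀ {a b} → Hom a b → Hom b a
    assoc   : ∀ {a b c d} {h : Hom c d} {g : Hom b c} {k : Hom a b} →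
              (h ∘ g) ∘ k ≈ h ∘ (g ∘ k)
    idˡ     : ∀ {a b} {k : Hom a b} → id ∘ k ≈ k
    idʳ     : ∀ {a b} {k : Hom a b} → k ∘ id ≈ k
    ∘-resp  : ∀ {a b c} {h h' : Hom b c} {k k' : Hom a b} →
              h ≈ h' → k ≈ k' → h ∘ k ≈ h' ∘ k'
    invˡ    : ∀ {a b} {k : Hom a b} → k ⁻¹ ∘ k ≈ id
    invʳ    : ∀ {a b} {k : Hom a b} → k ∘ k ⁻¹ ≈ id

  hom-setoid : Obj → Obj → Setoid 0ℓ 0ℓ
  hom-setoid a b = record { Carrier = Hom a b ; _≈_ = _≈_ ; isEquivalence = isEquiv }

  module _ {a b : Obj} where
    open IsEquivalence (isEquiv {a} {b}) public
      renaming (refl to ≈-refl; sym to ≈-sym; trans to ≈-trans)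

  idTo : ∀ {a b} → a ≡ b → Hom a b
  idTo refl = id

  square⁻¹ : ∀ {a b c d} {p : Hom a b} {q : Hom c d} {m : Hom a c} {n : Hom b d} →
             n ∘ p ≈ q ∘ m → n ⁻¹ ∘ q ≈ p ∘ m ⁻¹
  square⁻¹ {p = p} {q} {m} {n} sq = begin
      n ⁻¹ ∘ q                   ≈⟨ ≈-sym idʳ ⟩
      (n ⁻¹ ∘ q) ∘ id            ≈⟨ ∘-resp ≈-refl (≈-sym invʳ) ⟩
      (n ⁻¹ ∘ q) ∘ (m ∘ m ⁻¹)    ≈⟨ assoc ⟩
      n ⁻¹ ∘ (q ∘ (m ∘ m ⁻¹))    ≈⟨ ∘-resp ≈-refl (≈-sym assoc) ⟩
      n ⁻¹ ∘ ((q ∘ m) ∘ m ⁻¹)    ≈⟨ ∘-resp ≈-refl (∘-resp (≈-sym sq) ≈-refl) ⟩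
      n ⁻¹ ∘ ((n ∘ p) ∘ m ⁻¹)    ≈⟨ ∘-resp ≈-refl assoc ⟩
      n ⁻¹ ∘ (n ∘ (p ∘ m ⁻¹))    ≈⟨ ≈-sym assoc ⟩
      (n ⁻¹ ∘ n) ∘ (p ∘ m ⁻¹)    ≈⟨ ∘-resp invˡ ≈-refl ⟩
      id ∘ (p ∘ m ⁻¹)            ≈⟨ idˡ ⟩
      p ∘ m ⁻¹                   ∎
    where open SetoidR (hom-setoid _ _)

  inv-unique : ∀ {a b} {k : Hom a b} {j : Hom b a} → k ∘ j ≈ id → j ≈ k ⁻¹
  inv-unique {k = k} {j} e = begin
      j                 ≈⟨ ≈-sym idˡ ⟩
      id ∘ j            ≈⟨ ∘-resp (≈-sym invˡ) ≈-refl ⟩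
      (k ⁻¹ ∘ k) ∘ j    ≈⟨ assoc ⟩
      k ⁻¹ ∘ (k ∘ j)    ≈⟨ ∘-resp ≈-refl e ⟩
      k ⁻¹ ∘ id         ≈⟨ idʳ ⟩
      k ⁻¹              ∎
    where open SetoidR (hom-setoid _ _)

open Groupoid public using (Obj; Hom; idTo)

infix 4 _[_≈_]
_[_≈_] : (C : Groupoid) → ∀ {a b} → Hom C a b → Hom C a b → Set
C [ h ≈ k ] = Groupoid._≈_ C h k

infixr 9 _[_∘_]
_[_∘_] : (C : Groupoid) → ∀ {a b c} → Hom C b c → Hom C a b → Hom C a c
C [ h ∘ k ] = Groupoid._∘_ C h k

record Functor (C D : Groupoid) : Set where
  field
    F₀     : Obj C → Obj D
    F₁     : ∀ {a b} → Hom C a b → Hom D (F₀ a) (F₀ b)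
    F-resp : ∀ {a b} {h k : Hom C a b} → C [ h ≈ k ] → D [ F₁ h ≈ F₁ k ]
    F-id   : ∀ {a} → D [ F₁ (Groupoid.id C {a}) ≈ Groupoid.id D ]
    F-∘    : ∀ {a b c} {h : Hom C b c} {k : Hom C a b} →
             D [ F₁ (C [ h ∘ k ]) ≈ D [ F₁ h ∘ F₁ k ] ]

open Functor public

idF : ∀ {C} → Functor C C
idF {C} = record
  { F₀ = λ x → x ; F₁ = λ h → h ; F-resp = λ e → e
  ; F-id = Groupoid.≈-refl C ; F-∘ = Groupoid.≈-refl C }

infixr 9 _∘F_
_∘F_ : ∀ {C D E} → Functor D E → Functor C D → Functor C E
_∘F_ {C} {D} {E} G F = record
  { F₀ = λ x → F₀ G (F₀ F x)
  ; F₁ = λ h → F₁ G (F₁ F h)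
  ; F-resp = λ e → F-resp G (F-resp F e)
  ; F-id = Groupoid.≈-trans E (F-resp G (F-id F)) (F-id G)
  ; F-∘ = Groupoid.≈-trans E (F-resp G (F-∘ F)) (F-∘ G)
  }

F-inv : ∀ {C D} (F : Functor C D) {a b} (k : Hom C a b) →
        D [ F₁ F (Groupoid._⁻¹ C k) ≈ Groupoid._⁻¹ D (F₁ F k) ]
F-inv {C} {D} F k = Groupoid.inv-unique D
  (Groupoid.≈-trans D (Groupoid.≈-sym D (F-∘ F))
    (Groupoid.≈-trans D (F-resp F (Groupoid.invʳ C)) (F-id F)))

-- Natural transformations (automatically invertible in Gpd)

record NatTrans {C D : Groupoid} (F G : Functor C D) : Set where
  field
    η       : ∀ x → Hom D (F₀ F x) (F₀ G x)
    natural : ∀ {x y} (h : Hom C x y) →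
              D [ D [ η y ∘ F₁ F h ] ≈ D [ F₁ G h ∘ η x ] ]

open NatTrans public

infixr 9 _◁_
_◁_ : ∀ {C D E} (u : Functor D E) {F G : Functor C D} →
      NatTrans F G → NatTrans (u ∘F F) (u ∘F G)
_◁_ {E = E} u α = record
  { η = λ x → F₁ u (η α x)
  ; natural = λ h → Groupoid.≈-trans E (Groupoid.≈-sym E (F-∘ u))
      (Groupoid.≈-trans E (F-resp u (natural α h)) (F-∘ u))
  }

infixl 9 _▷_
_▷_ : ∀ {C D E} {F G : Functor D E} → NatTrans F G → (h : Functor C D) →
      NatTrans (F ∘F h) (G ∘F h)
α ▷ h = record { η = λ x → η α (F₀ h x) ; natural = λ k → natural α (F₁ h k) }

FunGpd : Groupoid → Groupoid → Groupoid
FunGpd X Y = record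
  { Obj = Functor X Y
  ; Hom = NatTrans
  ; _≈_ = λ α β → ∀ x → Y [ η α x ≈ η β x ]
  ; isEquiv = record
      { refl = λ x → Y.≈-refl
      ; sym = λ e x → Y.≈-sym (e x)
      ; trans = λ e e' x → Y.≈-trans (e x) (e' x) }
  ; id = λ {F} → record
      { η = λ x → Y.id
      ; natural = λ h → Y.≈-trans Y.idˡ (Y.≈-sym Y.idʳ) }
  ; _∘_ = λ {F} {G} {H} β α → record
      { η = λ x → η β x Y.∘ η α x
      ; natural = λ h → let open SetoidR (Y.hom-setoid _ _) in begin
          (η β _ Y.∘ η α _) Y.∘ F₁ F h   ≈⟨ Y.assoc ⟩
          η β _ Y.∘ (η α _ Y.∘ F₁ F h)   ≈⟨ Y.∘-resp Y.≈-refl (natural α h) ⟩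
          η β _ Y.∘ (F₁ G h Y.∘ η α _)   ≈⟨ Y.≈-sym Y.assoc ⟩
          (η β _ Y.∘ F₁ G h) Y.∘ η α _   ≈⟨ Y.∘-resp (natural β h) Y.≈-refl ⟩
          (F₁ H h Y.∘ η β _) Y.∘ η α _   ≈⟨ Y.assoc ⟩
          F₁ H h Y.∘ (η β _ Y.∘ η α _)   ∎ }
  ; _⁻¹ = λ α → record
      { η = λ x → η α x Y.⁻¹
      ; natural = λ h → Y.square⁻¹ (natural α h) }
  ; assoc = λ x → Y.assoc
  ; idˡ = λ x → Y.idˡ
  ; idʳ = λ x → Y.idʳ
  ; ∘-resp = λ e e' x → Y.∘-resp (e x) (e' x)
  ; invˡ = λ x → Y.invˡ
  ; invʳ = λ x → Y.invʳ
  }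
  where
    module Y = Groupoid Y

-- Strict equality of functors (as needed for 1-categorical pullbacks):
-- equal on objects, and equal on morphisms up to the induced identities.

infix 4 _≐_
_≐_ : ∀ {C D} → Functor C D → Functor C D → Set
_≐_ {C} {D} F G =
  Σ[ e ∈ (∀ x → F₀ F x ≡ F₀ G x) ]
    (∀ {x y} (h : Hom C x y) →
       D [ D [ F₁ G h ∘ idTo D (e x) ] ≈ D [ idTo D (e y) ∘ F₁ F h ] ])

idCell : ∀ {C D} {F G : Functor C D} → F ≐ G → NatTrans F G
idCell {D = D} (e , sq) = record
  { η = λ x → idTo D (e x) ; natural = λ h → Groupoid.≈-sym D (sq h) }

IsPullback : ∀ {S T B P} (f : Functor S B) (g : Functor T B)
             (l : Functor P S) (r : Functor P T) → Set₁
IsPullback {S} {T} {B} {P} f g l r =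
  (X : Groupoid) (a : Functor X S) (b : Functor X T) → f ∘F a ≐ g ∘F b →
    (Σ[ h ∈ Functor X P ] (l ∘F h ≐ a × r ∘F h ≐ b))
  × (∀ (h h' : Functor X P) → l ∘F h ≐ a → r ∘F h ≐ b →
                               l ∘F h' ≐ a → r ∘F h' ≐ b → h ≐ h')

record PsCone {S T B : Groupoid} (u : Functor S B) (v : Functor T B)
              (X : Groupoid) : Set where
  constructor pscone
  field
    l' : Functor X S
    r' : Functor X T
    ν  : NatTrans (u ∘F l') (v ∘F r')

record PsConeHom {S T B : Groupoid} {u : Functor S B} {v : Functor T B}
                 {X : Groupoid} (c d : PsCone u v X) : Set where
  constructor psconehom
  open PsCone
  field
    α  : NatTrans (l' c) (l' d)
    β  : NatTrans (r' c) (r' d)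
    eq : ∀ x → B [ B [ η (ν d) x ∘ F₁ u (η α x) ] ≈ B [ F₁ v (η β x) ∘ η (ν c) x ] ]

module PsConeOps {S T B : Groupoid} (u : Functor S B) (v : Functor T B) (X : Groupoid) where
  private
    module S = Groupoid S
    module T = Groupoid T
    module B = Groupoid B
  open PsCone
  open PsConeHom

  Cone : Set
  Cone = PsCone u v X

  _≈C_ : ∀ {c d : Cone} → PsConeHom c d → PsConeHom c d → Set
  m ≈C n = (∀ x → S [ η (α m) x ≈ η (α n) x ]) × (∀ x → T [ η (β m) x ≈ η (β n) x ])

  ≈C-isEquiv : ∀ {c d : Cone} → IsEquivalence (_≈C_ {c} {d})
  ≈C-isEquiv = record
    { refl = (λ x → S.≈-refl) , (λ x → T.≈-refl)
    ; sym = λ e → (λ x → S.≈-sym (proj₁ e x)) , (λ x → T.≈-sym (proj₂ e x))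
    ; trans = λ e d → (λ x → S.≈-trans (proj₁ e x) (proj₁ d x))
                     , (λ x → T.≈-trans (proj₂ e x) (proj₂ d x)) }

  idC-eq : (c : Cone) (x : Obj X) →
           B [ B [ η (ν c) x ∘ F₁ u (S.id {F₀ (l' c) x}) ] ≈ B [ F₁ v (T.id {F₀ (r' c) x}) ∘ η (ν c) x ] ]
  idC-eq c x = begin
      η (ν c) x B.∘ F₁ u S.id   ≈⟨ B.∘-resp B.≈-refl (F-id u) ⟩
      η (ν c) x B.∘ B.id        ≈⟨ B.idʳ ⟩
      η (ν c) x                 ≈⟨ B.≈-sym B.idˡ ⟩
      B.id B.∘ η (ν c) x        ≈⟨ B.∘-resp (B.≈-sym (F-id v)) B.≈-refl ⟩
      F₁ v T.id B.∘ η (ν c) x   ∎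
    where open SetoidR (B.hom-setoid _ _)

  idC : {c : Cone} → PsConeHom c c
  idC {c} = psconehom (Groupoid.id (FunGpd X S)) (Groupoid.id (FunGpd X T)) (idC-eq c)

  ∘C-eq : {c d e : Cone} (n : PsConeHom d e) (m : PsConeHom c d) (x : Obj X) →
          B [ B [ η (ν e) x ∘ F₁ u (η (α n) x S.∘ η (α m) x) ]
            ≈ B [ F₁ v (η (β n) x T.∘ η (β m) x) ∘ η (ν c) x ] ]
  ∘C-eq {c} {d} {e} n m x = begin
      νe B.∘ F₁ u (an S.∘ am)                 ≈⟨ B.∘-resp B.≈-refl (F-∘ u) ⟩
      νe B.∘ (F₁ u an B.∘ F₁ u am)            ≈⟨ B.≈-sym B.assoc ⟩
      (νe B.∘ F₁ u an) B.∘ F₁ u am            ≈⟨ B.∘-resp (eq n x) B.≈-refl ⟩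
      (F₁ v bn B.∘ νd) B.∘ F₁ u am            ≈⟨ B.assoc ⟩
      F₁ v bn B.∘ (νd B.∘ F₁ u am)            ≈⟨ B.∘-resp B.≈-refl (eq m x) ⟩
      F₁ v bn B.∘ (F₁ v bm B.∘ νc)            ≈⟨ B.≈-sym B.assoc ⟩
      (F₁ v bn B.∘ F₁ v bm) B.∘ νc            ≈⟨ B.∘-resp (B.≈-sym (F-∘ v)) B.≈-refl ⟩
      F₁ v (bn T.∘ bm) B.∘ νc                 ∎
    where
      open SetoidR (B.hom-setoid _ _)
      νe = η (ν e) x
      νd = η (ν d) x
      νc = η (ν c) x
      an = η (α n) x
      am = η (α m) x
      bn = η (β n) x
      bm = η (β m) x

  _∘C_ : {c d e : Cone} → PsConeHom d e → PsConeHom c d → PsConeHom c e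
  n ∘C m = psconehom (Groupoid._∘_ (FunGpd X S) (α n) (α m))
                     (Groupoid._∘_ (FunGpd X T) (β n) (β m)) (∘C-eq n m)

  invC-eq : {c d : Cone} (m : PsConeHom c d) (x : Obj X) →
            B [ B [ η (ν c) x ∘ F₁ u (η (α m) x S.⁻¹) ]
              ≈ B [ F₁ v (η (β m) x T.⁻¹) ∘ η (ν d) x ] ]
  invC-eq {c} {d} m x = begin
      η (ν c) x B.∘ F₁ u (η (α m) x S.⁻¹)
        ≈⟨ B.∘-resp B.≈-refl (F-inv u _) ⟩
      η (ν c) x B.∘ (F₁ u (η (α m) x) B.⁻¹)
        ≈⟨ B.≈-sym (B.square⁻¹ (B.≈-sym (eq m x))) ⟩
      (F₁ v (η (β m) x) B.⁻¹) B.∘ η (ν d) x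
        ≈⟨ B.∘-resp (B.≈-sym (F-inv v _)) B.≈-refl ⟩
      F₁ v (η (β m) x T.⁻¹) B.∘ η (ν d) x ∎
    where open SetoidR (B.hom-setoid _ _)

  invC : {c d : Cone} → PsConeHom c d → PsConeHom d c
  invC m = psconehom (Groupoid._⁻¹ (FunGpd X S) (α m)) (Groupoid._⁻¹ (FunGpd X T) (β m)) (invC-eq m)

PsConeGpd : ∀ {S T B : Groupoid} (u : Functor S B) (v : Functor T B) →
            Groupoid → Groupoid
PsConeGpd {S} {T} {B} u v X = record
  { Obj = PsCone u v X
  ; Hom = PsConeHom
  ; _≈_ = _≈C_
  ; isEquiv = ≈C-isEquiv
  ; id = idC
  ; _∘_ = _∘C_
  ; _⁻¹ = invC
  ; assoc = (λ x → S.assoc) , (λ x → T.assoc)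
  ; idˡ = (λ x → S.idˡ) , (λ x → T.idˡ)
  ; idʳ = (λ x → S.idʳ) , (λ x → T.idʳ)
  ; ∘-resp = λ e d → (λ x → S.∘-resp (proj₁ e x) (proj₁ d x))
                    , (λ x → T.∘-resp (proj₂ e x) (proj₂ d x))
  ; invˡ = (λ x → S.invˡ) , (λ x → T.invˡ)
  ; invʳ = (λ x → S.invʳ) , (λ x → T.invʳ)
  }
  where
    module S = Groupoid S
    module T = Groupoid T
    open PsConeOps u v X

record IsEquivalenceOfCats {C D : Groupoid} (F : Functor C D) : Set where
  field
    G    : Functor D C
    unit : NatTrans idF (G ∘F F)
    ε    : NatTrans (F ∘F G) idF

comparison : ∀ {S T B P : Groupoid} {u : Functor S B} {v : Functor T B}
             (l : Functor P S) (r : Functor P T) (μ : NatTrans (u ∘F l) (v ∘F r))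
             (X : Groupoid) → Functor (FunGpd X P) (PsConeGpd u v X)
comparison {S} {T} l r μ X = record
  { F₀ = λ h → pscone (l ∘F h) (r ∘F h)
             (record { η = λ x → η μ (F₀ h x) ; natural = λ k → natural μ (F₁ h k) })
  ; F₁ = λ θ → psconehom (l ◁ θ) (r ◁ θ) (λ x → natural μ (η θ x))
  ; F-resp = λ e → (λ x → F-resp l (e x)) , (λ x → F-resp r (e x))
  ; F-id = (λ x → F-id l) , (λ x → F-id r)
  ; F-∘ = (λ x → F-∘ l) , (λ x → F-∘ r)
  }

IsBipullback : ∀ {S T B P : Groupoid} (u : Functor S B) (v : Functor T B)
               (l : Functor P S) (r : Functor P T) (μ : NatTrans (u ∘F l) (v ∘F r)) →
               Set₁
IsBipullback u v l r μ = (X : Groupoid) → IsEquivalenceOfCats (comparison {u = u} {v = v} l r μ X)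

LiftingCondition : ∀ {S T B : Groupoid} (f : Functor S B) (g : Functor T B) → Set
LiftingCondition {S} {T} {B} f g =
  ∀ (s : Obj S) (t : Obj T) (θ : Hom B (F₀ f s) (F₀ g t)) →
    Σ[ s' ∈ Obj S ] Σ[ t' ∈ Obj T ] Σ[ φ ∈ Hom S s s' ] Σ[ ψ ∈ Hom T t' t ]
    Σ[ e ∈ F₀ f s' ≡ F₀ g t' ]
      B [ θ ≈ B [ F₁ g ψ ∘ B [ idTo B e ∘ F₁ f φ ] ] ]

{-# OPTIONS --safe --with-K #-}
-- Pseudocones with vertex X are functors from X into the iso-comma groupoid of f and g (objects
-- (s, t, θ : f s ≅ g t)), and the comparison functor is post-composition with
-- p ↦ (l p, r p, id). Since the square is a strict pullback, the latter is fully faithful: test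
-- the pullback property on the free-standing isomorphism. Hence the comparison functors are
-- equivalences iff it is essentially surjective (necessity: take X = 1); a pseudo-inverse picks an
-- essential preimage at each vertex of a cone and lifts morphisms uniquely. Finally, an
-- isomorphism (s, t, θ) ≅ (l p, r p, id) is exactly a factorisation θ = g ψ ∘ f φ through an
-- object f s' = g t', and every such pair (s', t') lifts to P.
module Submission where

open import Defs
open import Data.Bool using (Bool; true; false)
open import Data.Product using (_×_; Σ-syntax; _,_; proj₁; proj₂)
open import Data.Unit using (⊤; tt)
open import Relation.Binary.PropositionalEquality using (_≡_; refl; sym)
open import Axiom.UniquenessOfIdentityProofs.WithK using (uip)
import Relation.Binary.Reasoning.Setoid as SetoidR

module GroupoidProperties (C : Groupoid) where
  open Groupoid C public hiding (idTo)

  square-id : ∀ {a b} {k : Hom C a b} {x : Hom C a a} {y : Hom C b b} →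
              x ≈ id → y ≈ id → k ∘ x ≈ y ∘ k
  square-id {k = k} {x} {y} x≈id y≈id = begin
      k ∘ x    ≈⟨ ∘-resp ≈-refl x≈id ⟩
      k ∘ id   ≈⟨ idʳ ⟩
      k        ≈⟨ ≈-sym idˡ ⟩
      id ∘ k   ≈⟨ ∘-resp (≈-sym y≈id) ≈-refl ⟩
      y ∘ k    ∎
    where open SetoidR (hom-setoid _ _)

  id-comm : ∀ {a b} {k : Hom C a b} → k ∘ id ≈ id ∘ k
  id-comm = square-id ≈-refl ≈-refl

  paste : ∀ {a₁ a₂ a₃ b₁ b₂ b₃}
          {k₁ : Hom C a₁ b₁} {k₂ : Hom C a₂ b₂} {k₃ : Hom C a₃ b₃}
          {x₁ : Hom C a₁ a₂} {x₂ : Hom C a₂ a₃} {y₁ : Hom C b₁ b₂} {y₂ : Hom C b₂ b₃} →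
          k₃ ∘ x₂ ≈ y₂ ∘ k₂ → k₂ ∘ x₁ ≈ y₁ ∘ k₁ → k₃ ∘ (x₂ ∘ x₁) ≈ (y₂ ∘ y₁) ∘ k₁
  paste {k₁ = k₁} {k₂} {k₃} {x₁} {x₂} {y₁} {y₂} sq₂ sq₁ = begin
      k₃ ∘ (x₂ ∘ x₁)    ≈⟨ ≈-sym assoc ⟩
      (k₃ ∘ x₂) ∘ x₁    ≈⟨ ∘-resp sq₂ ≈-refl ⟩
      (y₂ ∘ k₂) ∘ x₁    ≈⟨ assoc ⟩
      y₂ ∘ (k₂ ∘ x₁)    ≈⟨ ∘-resp ≈-refl sq₁ ⟩
      y₂ ∘ (y₁ ∘ k₁)    ≈⟨ ≈-sym assoc ⟩
      (y₂ ∘ y₁) ∘ k₁    ∎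
    where open SetoidR (hom-setoid _ _)

  cancelˡ : ∀ {a b c} {k : Hom C b c} {x y : Hom C a b} → k ∘ x ≈ k ∘ y → x ≈ y
  cancelˡ {k = k} {x} {y} kx≈ky = begin
      x                 ≈⟨ ≈-sym idˡ ⟩
      id ∘ x            ≈⟨ ∘-resp (≈-sym invˡ) ≈-refl ⟩
      (k ⁻¹ ∘ k) ∘ x    ≈⟨ assoc ⟩
      k ⁻¹ ∘ (k ∘ x)    ≈⟨ ∘-resp ≈-refl kx≈ky ⟩
      k ⁻¹ ∘ (k ∘ y)    ≈⟨ ≈-sym assoc ⟩
      (k ⁻¹ ∘ k) ∘ y    ≈⟨ ∘-resp invˡ ≈-refl ⟩
      id ∘ y            ≈⟨ idˡ ⟩
      y                 ∎
    where open SetoidR (hom-setoid _ _)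

  cancel-⁻¹ʳ : ∀ {a b c} {x : Hom C b c} {z : Hom C a b} → (x ∘ z) ∘ z ⁻¹ ≈ x
  cancel-⁻¹ʳ = ≈-trans assoc (≈-trans (∘-resp ≈-refl invʳ) idʳ)

  moveˡ-⁻¹ : ∀ {a b c} {k : Hom C b c} {m : Hom C a b} {n : Hom C a c} →
             m ≈ k ⁻¹ ∘ n → k ∘ m ≈ n
  moveˡ-⁻¹ {k = k} {m} {n} m≈ = begin
      k ∘ m             ≈⟨ ∘-resp ≈-refl m≈ ⟩
      k ∘ (k ⁻¹ ∘ n)    ≈⟨ ≈-sym assoc ⟩
      (k ∘ k ⁻¹) ∘ n    ≈⟨ ∘-resp invʳ ≈-refl ⟩
      id ∘ n            ≈⟨ idˡ ⟩
      n                 ∎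
    where open SetoidR (hom-setoid _ _)

  ⁻¹-resp : ∀ {a b} {m m' : Hom C a b} → m ≈ m' → m ⁻¹ ≈ m' ⁻¹
  ⁻¹-resp m≈m' = inv-unique (≈-trans (∘-resp (≈-sym m≈m') ≈-refl) invʳ)

  idTo-loop : ∀ {a b} {m m' : Hom C a b} (e₀ : a ≡ a) (e₁ : b ≡ b) →
              m' ∘ idTo C e₀ ≈ idTo C e₁ ∘ m → m ≈ m'
  idTo-loop refl refl sq = ≈-sym (≈-trans (≈-sym idʳ) (≈-trans sq idˡ))

F₁-transport : ∀ {P C : Groupoid} (k : Functor P C) {p₀ q₀ p q : Obj P} (m : Hom P p₀ q₀)
               (ep : p₀ ≡ p) (eq : q₀ ≡ q) {α : Hom C (F₀ k p) (F₀ k q)}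
               (d₀ : F₀ k p₀ ≡ F₀ k p) (d₁ : F₀ k q₀ ≡ F₀ k q) →
               C [ C [ α ∘ idTo C d₀ ] ≈ C [ idTo C d₁ ∘ F₁ k m ] ] →
               C [ F₁ k (P [ idTo P eq ∘ P [ m ∘ idTo P (sym ep) ] ]) ≈ α ]
F₁-transport {P} {C} k m refl refl refl refl sq =
  C.≈-trans (F-resp k (P.≈-trans P.idˡ P.idʳ)) (C.idTo-loop refl refl sq)
  where
    module P = Groupoid P
    module C = GroupoidProperties C

Indiscrete : Set → Groupoid
Indiscrete A = record
  { Obj = A ; Hom = λ _ _ → ⊤ ; _≈_ = λ _ _ → ⊤
  ; isEquiv = record { refl = tt ; sym = λ _ → tt ; trans = λ _ _ → tt }
  ; id = tt ; _∘_ = λ _ _ → tt ; _⁻¹ = λ _ → tt ; assoc = tt ; idˡ = tt ; idʳ = tt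
  ; ∘-resp = λ _ _ → tt ; invˡ = tt ; invʳ = tt }

Point : Groupoid
Point = Indiscrete ⊤

Interval : Groupoid
Interval = Indiscrete Bool

module _ (C : Groupoid) where
  open Groupoid C hiding (idTo)

  constF : Obj C → Functor Point C
  constF x = record
    { F₀ = λ _ → x ; F₁ = λ _ → id ; F-resp = λ _ → ≈-refl ; F-id = ≈-refl
    ; F-∘ = ≈-sym idˡ }

  endpoint : Obj C → Obj C → Bool → Obj C
  endpoint p q false = p
  endpoint p q true  = q

  arrow₁ : ∀ {p q} → Hom C p q → (i j : Bool) → Hom C (endpoint p q i) (endpoint p q j)
  arrow₁ m false false = id
  arrow₁ m false true  = m
  arrow₁ m true  false = m ⁻¹
  arrow₁ m true  true  = id

  arrow : ∀ {p q} → Hom C p q → Functor Interval C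
  arrow {p} {q} m = record
    { F₀ = endpoint p q
    ; F₁ = λ {i} {j} _ → arrow₁ m i j
    ; F-resp = λ _ → ≈-refl
    ; F-id = λ {i} → arrow-id i
    ; F-∘ = λ {i} {j} {k} → arrow-∘ i j k }
    where
      arrow-id : ∀ i → arrow₁ m i i ≈ id
      arrow-id false = ≈-refl
      arrow-id true  = ≈-refl
      arrow-∘ : ∀ i j k → arrow₁ m i k ≈ arrow₁ m j k ∘ arrow₁ m i j
      arrow-∘ false false false = ≈-sym idˡ
      arrow-∘ false false true  = ≈-sym idʳ
      arrow-∘ false true  false = ≈-sym invˡ
      arrow-∘ false true  true  = ≈-sym idˡ
      arrow-∘ true  false false = ≈-sym idˡ
      arrow-∘ true  false true  = ≈-sym invʳ
      arrow-∘ true  true  false = ≈-sym idʳ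
      arrow-∘ true  true  true  = ≈-sym idˡ

≐-refl : ∀ {C D} {F : Functor C D} → F ≐ F
≐-refl {D = D} = (λ _ → refl) , λ _ → GroupoidProperties.id-comm D

≐-whiskerʳ : ∀ {C D E} {F G : Functor D E} → F ≐ G → (H : Functor C D) → F ∘F H ≐ G ∘F H
≐-whiskerʳ (e , sq) H = (λ x → e (F₀ H x)) , λ h → sq (F₁ H h)

const-≐ : ∀ {C C' D} (F : Functor C D) (G : Functor C' D) {x y} →
          F₀ F x ≡ F₀ G y → F ∘F constF C x ≐ G ∘F constF C' y
const-≐ {D = D} F G e =
  (λ _ → e) , λ _ → Groupoid.≈-sym D (GroupoidProperties.square-id D (F-id F) (F-id G))

∘-const-≐ : ∀ {C D} (k : Functor C D) {x y} → F₀ k x ≡ y → k ∘F constF C x ≐ constF D y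
∘-const-≐ k = const-≐ k idF

arrow-≐ : ∀ {P C} (k : Functor P C) {p q} {m m' : Hom P p q} →
          C [ F₁ k m ≈ F₁ k m' ] → k ∘F arrow P m' ≐ k ∘F arrow P m
arrow-≐ {P} {C} k {m = m} {m'} km≈km' =
  (λ _ → refl) , λ {i} {j} _ → C.≈-trans C.idʳ (C.≈-trans (images-≈ i j) (C.≈-sym C.idˡ))
  where
    module C = GroupoidProperties C
    images-≈ : ∀ i j → C [ F₁ k (arrow₁ P m i j) ≈ F₁ k (arrow₁ P m' i j) ]
    images-≈ false false = C.≈-refl
    images-≈ false true  = km≈km'
    images-≈ true  false =
      C.≈-trans (F-inv k m) (C.≈-trans (C.⁻¹-resp km≈km') (C.≈-sym (F-inv k m')))
    images-≈ true  true  = C.≈-refl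

module IsoComma {S T B : Groupoid} (f : Functor S B) (g : Functor T B) where
  private
    module S = Groupoid S
    module T = Groupoid T
    module B = GroupoidProperties B

  Square : ∀ {s₁ t₁ s₂ t₂} → Hom B (F₀ f s₁) (F₀ g t₁) → Hom B (F₀ f s₂) (F₀ g t₂) →
           Hom S s₁ s₂ → Hom T t₁ t₂ → Set
  Square θ₁ θ₂ α β = B [ B [ θ₂ ∘ F₁ f α ] ≈ B [ F₁ g β ∘ θ₁ ] ]

  square-id : ∀ {s t} {θ : Hom B (F₀ f s) (F₀ g t)} → Square θ θ S.id T.id
  square-id = B.square-id (F-id f) (F-id g)

  square-∘ : ∀ {s₁ t₁ s₂ t₂ s₃ t₃} {θ₁ : Hom B (F₀ f s₁) (F₀ g t₁)}
             {θ₂ : Hom B (F₀ f s₂) (F₀ g t₂)} {θ₃ : Hom B (F₀ f s₃) (F₀ g t₃)}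
             {α₁ : Hom S s₁ s₂} {β₁ : Hom T t₁ t₂} {α₂ : Hom S s₂ s₃} {β₂ : Hom T t₂ t₃} →
             Square θ₂ θ₃ α₂ β₂ → Square θ₁ θ₂ α₁ β₁ → Square θ₁ θ₃ (α₂ S.∘ α₁) (β₂ T.∘ β₁)
  square-∘ sq₂ sq₁ =
    B.≈-trans (B.∘-resp B.≈-refl (F-∘ f)) (B.≈-trans (B.paste sq₂ sq₁) (B.∘-resp (B.≈-sym (F-∘ g)) B.≈-refl))

  square-⁻¹ : ∀ {s₁ t₁ s₂ t₂} {θ₁ : Hom B (F₀ f s₁) (F₀ g t₁)} {θ₂ : Hom B (F₀ f s₂) (F₀ g t₂)}
              {α : Hom S s₁ s₂} {β : Hom T t₁ t₂} →
              Square θ₁ θ₂ α β → Square θ₂ θ₁ (α S.⁻¹) (β T.⁻¹)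
  square-⁻¹ {α = α} {β} sq =
    B.≈-trans (B.∘-resp B.≈-refl (F-inv f α))
      (B.≈-trans (B.≈-sym (B.square⁻¹ (B.≈-sym sq))) (B.∘-resp (B.≈-sym (F-inv g β)) B.≈-refl))

  square⇒arrow-≐ : ∀ {s₁ t₁ s₂ t₂} {e₁ : F₀ f s₁ ≡ F₀ g t₁} {e₂ : F₀ f s₂ ≡ F₀ g t₂}
                   {α : Hom S s₁ s₂} {β : Hom T t₁ t₂} →
                   Square (idTo B e₁) (idTo B e₂) α β → f ∘F arrow S α ≐ g ∘F arrow T β
  square⇒arrow-≐ {s₁} {t₁} {s₂} {t₂} {e₁} {e₂} {α} {β} sq =
    e , λ {i} {j} _ → B.≈-sym (squares i j)
    where
      e : ∀ i → F₀ f (endpoint S s₁ s₂ i) ≡ F₀ g (endpoint T t₁ t₂ i)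
      e false = e₁
      e true  = e₂
      squares : ∀ i j → Square (idTo B (e i)) (idTo B (e j)) (arrow₁ S α i j) (arrow₁ T β i j)
      squares false false = square-id
      squares false true  = sq
      squares true  false = square-⁻¹ sq
      squares true  true  = square-id

module CommutingSquare {S T B P : Groupoid} (f : Functor S B) (g : Functor T B)
                       (l : Functor P S) (r : Functor P T) (comm : f ∘F l ≐ g ∘F r) where
  private
    module S = GroupoidProperties S
    module T = GroupoidProperties T
    module B = GroupoidProperties B
    module P = GroupoidProperties P
  open IsoComma f g

  commAt : (p : Obj P) → Hom B (F₀ f (F₀ l p)) (F₀ g (F₀ r p))
  commAt p = idTo B (proj₁ comm p)

  -- An isomorphism (l p, r p, commAt p) ≅ (s, t, θ) in the iso-comma groupoid of f and g.
  record EssPreimage (s : Obj S) (t : Obj T) (θ : Hom B (F₀ f s) (F₀ g t)) : Set where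
    field
      point  : Obj P
      toS    : Hom S (F₀ l point) s
      toT    : Hom T (F₀ r point) t
      square : Square (commAt point) θ toS toT

  EssentiallySurjective : Set
  EssentiallySurjective = ∀ s t θ → EssPreimage s t θ

  essentiallySurjective⇒lifting : EssentiallySurjective → LiftingCondition f g
  essentiallySurjective⇒lifting ess s t θ =
    F₀ l point , F₀ r point , toS S.⁻¹ , toT , proj₁ comm point , factorisation
    where
      open EssPreimage (ess s t θ)
      factorisation : B [ θ ≈ B [ F₁ g toT ∘ B [ commAt point ∘ F₁ f (toS S.⁻¹) ] ] ]
      factorisation = begin
          θ                                                ≈⟨ B.≈-sym B.cancel-⁻¹ʳ ⟩
          (θ B.∘ F₁ f toS) B.∘ (F₁ f toS B.⁻¹)             ≈⟨ B.∘-resp square B.≈-refl ⟩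
          (F₁ g toT B.∘ commAt point) B.∘ (F₁ f toS B.⁻¹)  ≈⟨ B.assoc ⟩
          F₁ g toT B.∘ (commAt point B.∘ (F₁ f toS B.⁻¹))
            ≈⟨ B.∘-resp B.≈-refl (B.∘-resp B.≈-refl (B.≈-sym (F-inv f toS))) ⟩
          F₁ g toT B.∘ (commAt point B.∘ F₁ f (toS S.⁻¹))  ∎
        where open SetoidR (B.hom-setoid _ _)

  bipullback⇒essentiallySurjective : IsBipullback f g l r (idCell comm) → EssentiallySurjective
  bipullback⇒essentiallySurjective bp s t θ = record
    { point  = F₀ (F₀ G cone) tt
    ; toS    = η (PsConeHom.α (η ε cone)) tt
    ; toT    = η (PsConeHom.β (η ε cone)) tt
    ; square = PsConeHom.eq (η ε cone) tt
    }
    where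
      open IsEquivalenceOfCats (bp Point)
      cone : PsCone f g Point
      cone = pscone (constF S s) (constF T t) (record { η = λ _ → θ ; natural = λ _ → square-id })

  trivialPreimage : (p : Obj P) → EssPreimage (F₀ l p) (F₀ r p) (commAt p)
  trivialPreimage p = record { point = p ; toS = S.id ; toT = T.id ; square = square-id }

  record Over {s₁ t₁ s₂ t₂} {θ₁ : Hom B (F₀ f s₁) (F₀ g t₁)} {θ₂ : Hom B (F₀ f s₂) (F₀ g t₂)}
              (c₁ : EssPreimage s₁ t₁ θ₁) (c₂ : EssPreimage s₂ t₂ θ₂) (α : Hom S s₁ s₂) (β : Hom T t₁ t₂)
              (m : Hom P (EssPreimage.point c₁) (EssPreimage.point c₂)) : Set where
    constructor over
    open EssPreimage
    field
      onS : S [ S [ toS c₂ ∘ F₁ l m ] ≈ S [ α ∘ toS c₁ ] ]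
      onT : T [ T [ toT c₂ ∘ F₁ r m ] ≈ T [ β ∘ toT c₁ ] ]
  open Over

  over-∘ : ∀ {s₁ t₁ s₂ t₂ s₃ t₃} {θ₁ : Hom B (F₀ f s₁) (F₀ g t₁)}
           {θ₂ : Hom B (F₀ f s₂) (F₀ g t₂)} {θ₃ : Hom B (F₀ f s₃) (F₀ g t₃)}
           {c₁ : EssPreimage s₁ t₁ θ₁} {c₂ : EssPreimage s₂ t₂ θ₂} {c₃ : EssPreimage s₃ t₃ θ₃}
           {α₁ β₁ α₂ β₂ m₁ m₂} → Over c₂ c₃ α₂ β₂ m₂ → Over c₁ c₂ α₁ β₁ m₁ →
           Over c₁ c₃ (α₂ S.∘ α₁) (β₂ T.∘ β₁) (m₂ P.∘ m₁)
  over-∘ (over ol₂ or₂) (over ol₁ or₁) = over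
    (S.≈-trans (S.∘-resp S.≈-refl (F-∘ l)) (S.paste ol₂ ol₁))
    (T.≈-trans (T.∘-resp T.≈-refl (F-∘ r)) (T.paste or₂ or₁))

  over-id : ∀ {s t} {θ : Hom B (F₀ f s) (F₀ g t)} {c : EssPreimage s t θ} → Over c c S.id T.id P.id
  over-id = over (S.square-id (F-id l) S.≈-refl) (T.square-id (F-id r) T.≈-refl)

  over-trivial : ∀ {p q} (m : Hom P p q) →
                 Over (trivialPreimage p) (trivialPreimage q) (F₁ l m) (F₁ r m) m
  over-trivial m = over (S.≈-sym S.id-comm) (T.≈-sym T.id-comm)

  module _ (pb : IsPullback f g l r) where

    pullback-point : ∀ {s t} → F₀ f s ≡ F₀ g t → Σ[ p ∈ Obj P ] (F₀ l p ≡ s × F₀ r p ≡ t)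
    pullback-point {s} {t} e with proj₁ (pb Point (constF S s) (constF T t) (const-≐ f g e))
    ... | h , hl , hr = F₀ h tt , proj₁ hl tt , proj₁ hr tt

    pullback-point-unique : ∀ {p q} → F₀ l p ≡ F₀ l q → F₀ r p ≡ F₀ r q → p ≡ q
    pullback-point-unique {p} {q} el er = proj₁ same tt
      where
        same : constF P p ≐ constF P q
        same = proj₂ (pb Point (constF S (F₀ l p)) (constF T (F₀ r p)) (const-≐ f g (proj₁ comm p)))
                 (constF P p) (constF P q)
                 (∘-const-≐ l refl) (∘-const-≐ r refl) (∘-const-≐ l (sym el)) (∘-const-≐ r (sym er))

    pullback-faithful : ∀ {p q} {m m' : Hom P p q} →
                        S [ F₁ l m ≈ F₁ l m' ] → T [ F₁ r m ≈ F₁ r m' ] → P [ m ≈ m' ]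
    pullback-faithful {m = m} {m'} el er = P.idTo-loop (e false) (e true) (sq {false} {true} tt)
      where
        same : arrow P m ≐ arrow P m'
        same = proj₂ (pb Interval (l ∘F arrow P m) (r ∘F arrow P m)
                         (≐-whiskerʳ {F = f ∘F l} {G = g ∘F r} comm (arrow P m)))
                 (arrow P m) (arrow P m') (≐-refl {F = l ∘F arrow P m}) (≐-refl {F = r ∘F arrow P m})
                 (arrow-≐ l el) (arrow-≐ r er)
        e = proj₁ same
        sq = proj₂ same

    pullback-full : ∀ {p q} {α : Hom S (F₀ l p) (F₀ l q)} {β : Hom T (F₀ r p) (F₀ r q)} →
                    Square (commAt p) (commAt q) α β →
                    Σ[ m ∈ Hom P p q ] (S [ F₁ l m ≈ α ] × T [ F₁ r m ≈ β ])
    pullback-full {p} {q} {α} {β} sq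
      with proj₁ (pb Interval (arrow S α) (arrow T β)
                     (square⇒arrow-≐ {e₁ = proj₁ comm p} {e₂ = proj₁ comm q} sq))
    ... | H , (dl , sql) , (dr , sqr) =
      m , F₁-transport l (F₁ H tt) ep eq (dl false) (dl true) (sql {false} {true} tt)
        , F₁-transport r (F₁ H tt) ep eq (dr false) (dr true) (sqr {false} {true} tt)
      where
        ep = pullback-point-unique (dl false) (dr false)
        eq = pullback-point-unique (dl true) (dr true)
        m = idTo P eq P.∘ (F₁ H {false} {true} tt P.∘ idTo P (sym ep))

    lifting⇒essentiallySurjective : LiftingCondition f g → EssentiallySurjective
    lifting⇒essentiallySurjective lc s t θ with lc s t θ
    ... | s' , t' , φ , ψ , e , θ≈ with pullback-point e
    ... | p , dl , dr = record
      { point = p ; toS = φ S.⁻¹ S.∘ idTo S dl ; toT = ψ T.∘ idTo T dr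
      ; square = factorisation⇒square dl dr }
      where
        factorisation⇒square : (dl : F₀ l p ≡ s') (dr : F₀ r p ≡ t') →
                               Square (commAt p) θ (φ S.⁻¹ S.∘ idTo S dl) (ψ T.∘ idTo T dr)
        factorisation⇒square refl refl with uip e (proj₁ comm p)
        ... | refl = begin
            θ B.∘ F₁ f (φ S.⁻¹ S.∘ S.id)                            ≈⟨ B.∘-resp B.≈-refl (F-resp f S.idʳ) ⟩
            θ B.∘ F₁ f (φ S.⁻¹)                                     ≈⟨ B.∘-resp θ≈ (F-inv f φ) ⟩
            (F₁ g ψ B.∘ (commAt p B.∘ F₁ f φ)) B.∘ (F₁ f φ B.⁻¹)    ≈⟨ B.∘-resp (B.≈-sym B.assoc) B.≈-refl ⟩
            ((F₁ g ψ B.∘ commAt p) B.∘ F₁ f φ) B.∘ (F₁ f φ B.⁻¹)    ≈⟨ B.cancel-⁻¹ʳ ⟩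
            F₁ g ψ B.∘ commAt p                                     ≈⟨ B.∘-resp (F-resp g (T.≈-sym T.idʳ)) B.≈-refl ⟩
            F₁ g (ψ T.∘ T.id) B.∘ commAt p                          ∎
          where open SetoidR (B.hom-setoid _ _)

    over-unique : ∀ {s₁ t₁ s₂ t₂} {θ₁ : Hom B (F₀ f s₁) (F₀ g t₁)} {θ₂ : Hom B (F₀ f s₂) (F₀ g t₂)}
                  {c₁ : EssPreimage s₁ t₁ θ₁} {c₂ : EssPreimage s₂ t₂ θ₂} {α α' β β' m m'} →
                  Over c₁ c₂ α β m → Over c₁ c₂ α' β' m' →
                  S [ α ≈ α' ] → T [ β ≈ β' ] → P [ m ≈ m' ]
    over-unique (over ol or) (over ol' or') α≈α' β≈β' = pullback-faithful
      (S.cancelˡ (S.≈-trans ol (S.≈-trans (S.∘-resp α≈α' S.≈-refl) (S.≈-sym ol'))))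
      (T.cancelˡ (T.≈-trans or (T.≈-trans (T.∘-resp β≈β' T.≈-refl) (T.≈-sym or'))))

    -- Only the Over specification of lifted morphisms is ever used; letting Agda unfold
    -- them makes checking the functor laws of the pseudo-inverse intractable.
    abstract
      lift : ∀ {s₁ t₁ s₂ t₂} {θ₁ : Hom B (F₀ f s₁) (F₀ g t₁)} {θ₂ : Hom B (F₀ f s₂) (F₀ g t₂)}
             (c₁ : EssPreimage s₁ t₁ θ₁) (c₂ : EssPreimage s₂ t₂ θ₂) {α β} → Square θ₁ θ₂ α β →
             Σ[ m ∈ Hom P (EssPreimage.point c₁) (EssPreimage.point c₂) ] Over c₁ c₂ α β m
      lift c₁ c₂ {α} {β} sq =
        let m , lm≈ , rm≈ = pullback-full conjugated in m , over (S.moveˡ-⁻¹ lm≈) (T.moveˡ-⁻¹ rm≈)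
        where
          open EssPreimage
          conjugated : Square (commAt (point c₁)) (commAt (point c₂))
                              (toS c₂ S.⁻¹ S.∘ (α S.∘ toS c₁)) (toT c₂ T.⁻¹ T.∘ (β T.∘ toT c₁))
          conjugated = square-∘ (square-⁻¹ (square c₂)) (square-∘ sq (square c₁))

    module Pseudoinverse (ess : EssentiallySurjective) (X : Groupoid) where
      open PsCone
      open PsConeHom
      private module X = Groupoid X

      Cmp : Functor (FunGpd X P) (PsConeGpd f g X)
      Cmp = comparison l r (idCell comm) X

      chosen : (c : PsCone f g X) (x : Obj X) → EssPreimage (F₀ (l' c) x) (F₀ (r' c) x) (η (ν c) x)
      chosen c x = ess _ _ _

      onHom : (c : PsCone f g X) {x y : Obj X} (h : Hom X x y) →
              Σ[ m ∈ Hom P _ _ ] Over (chosen c x) (chosen c y) (F₁ (l' c) h) (F₁ (r' c) h) m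
      onHom c {x} {y} h = lift (chosen c x) (chosen c y) (natural (ν c) h)

      onConeHom : ∀ {c d} (M : PsConeHom c d) (x : Obj X) →
                  Σ[ m ∈ Hom P _ _ ] Over (chosen c x) (chosen d x) (η (α M) x) (η (β M) x) m
      onConeHom {c} {d} M x = lift (chosen c x) (chosen d x) (eq M x)

      G₀ : PsCone f g X → Functor X P
      G₀ c = record
        { F₀ = λ x → EssPreimage.point (chosen c x)
        ; F₁ = λ h → proj₁ (onHom c h)
        ; F-resp = λ {_} {_} {h} {k} h≈k →
            over-unique (proj₂ (onHom c h)) (proj₂ (onHom c k))
              (F-resp (l' c) h≈k) (F-resp (r' c) h≈k)
        ; F-id = over-unique (proj₂ (onHom c X.id)) over-id (F-id (l' c)) (F-id (r' c))
        ; F-∘ = λ {_} {_} {_} {h} {k} →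
            over-unique (proj₂ (onHom c (h X.∘ k))) (over-∘ (proj₂ (onHom c h)) (proj₂ (onHom c k)))
              (F-∘ (l' c)) (F-∘ (r' c))
        }

      G₁ : ∀ {c d} → PsConeHom c d → NatTrans (G₀ c) (G₀ d)
      G₁ {c} {d} M = record
        { η = λ x → proj₁ (onConeHom M x)
        ; natural = λ {x} {y} h →
            over-unique (over-∘ (proj₂ (onConeHom M y)) (proj₂ (onHom c h)))
                        (over-∘ (proj₂ (onHom d h)) (proj₂ (onConeHom M x)))
                        (natural (α M) h) (natural (β M) h)
        }

      G : Functor (PsConeGpd f g X) (FunGpd X P)
      G = record
        { F₀ = G₀
        ; F₁ = G₁
        ; F-resp = λ {_} {_} {M} {M'} M≈M' x →
            over-unique (proj₂ (onConeHom M x)) (proj₂ (onConeHom M' x))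
              (proj₁ M≈M' x) (proj₂ M≈M' x)
        ; F-id = λ {c} x →
            over-unique (proj₂ (onConeHom (Groupoid.id (PsConeGpd f g X) {c}) x)) over-id
              S.≈-refl T.≈-refl
        ; F-∘ = λ {_} {_} {_} {N} {M} x →
            over-unique (proj₂ (onConeHom (PsConeGpd f g X [ N ∘ M ]) x))
              (over-∘ (proj₂ (onConeHom N x)) (proj₂ (onConeHom M x))) S.≈-refl T.≈-refl
        }

      unitAt : (k : Functor X P) (x : Obj X) →
               Σ[ m ∈ Hom P _ _ ] Over (trivialPreimage (F₀ k x)) (chosen (F₀ Cmp k) x) S.id T.id m
      unitAt k x = lift (trivialPreimage (F₀ k x)) (chosen (F₀ Cmp k) x) square-id

      unit : NatTrans idF (G ∘F Cmp)
      unit = record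
        { η = λ k → record
            { η = λ x → proj₁ (unitAt k x)
            ; natural = λ h →
                over-unique (over-∘ (proj₂ (unitAt k _)) (over-trivial (F₁ k h)))
                            (over-∘ (proj₂ (onHom (F₀ Cmp k) h)) (proj₂ (unitAt k _)))
                            (S.≈-sym S.id-comm) (T.≈-sym T.id-comm)
            }
        ; natural = λ {k} {k'} θ x →
            over-unique (over-∘ (proj₂ (unitAt k' x)) (over-trivial (η θ x)))
                        (over-∘ (proj₂ (onConeHom (F₁ Cmp θ) x)) (proj₂ (unitAt k x)))
                        (S.≈-sym S.id-comm) (T.≈-sym T.id-comm)
        }

      counit : NatTrans (Cmp ∘F G) idF
      counit = record
        { η = λ c → psconehom
            (record { η = λ x → EssPreimage.toS (chosen c x) ; natural = λ h → onS (proj₂ (onHom c h)) })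
            (record { η = λ x → EssPreimage.toT (chosen c x) ; natural = λ h → onT (proj₂ (onHom c h)) })
            (λ x → EssPreimage.square (chosen c x))
        ; natural = λ M → (λ x → onS (proj₂ (onConeHom M x))) , (λ x → onT (proj₂ (onConeHom M x)))
        }

      isEquivalence : IsEquivalenceOfCats Cmp
      isEquivalence = record { G = G ; unit = unit ; ε = counit }

    essentiallySurjective⇒bipullback : EssentiallySurjective → IsBipullback f g l r (idCell comm)
    essentiallySurjective⇒bipullback = Pseudoinverse.isEquivalence

lemma1 : (S T B P : Groupoid) (f : Functor S B) (g : Functor T B)
         (l : Functor P S) (r : Functor P T)
         (comm : f ∘F l ≐ g ∘F r) →
         IsPullback f g l r →
         (IsBipullback f g l r (idCell comm) → LiftingCondition f g)
         × (LiftingCondition f g → IsBipullback f g l r (idCell comm))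
lemma1 S T B P f g l r comm pb =
    (λ bp → essentiallySurjective⇒lifting (bipullback⇒essentiallySurjective bp))
  , (λ lc → essentiallySurjective⇒bipullback pb (lifting⇒essentiallySurjective pb lc))
  where open CommutingSquare f g l r comm
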